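{- For a tree $T$ with $n$ nodes and maximal degree $\Delta$, $|E_{fix}(T)|\le F_{n-\lceil \Delta/2\rceil}$.
   Context: For a tree $T=(V,E)$, $E_{fix}(T)$ is the set of all $F\subseteq E$ with $2deg_F(v)\le deg(v)$ for every $v\in V$, where $deg_F(v)$ is the number of edges of $F$ incident to $v$ and $deg(v)$ is the degree of $v$ in $T$. $F_i$ denotes the $i$-th Fibonacci number: $F_0=0$, $F_1=1$, $F_i=F_{i-1}+F_{i-2}$. -}

module Defs where

open import Data.Nat using (ℕ; zero; suc; _+_; _*_; _≤_; _≤?_)
open import Data.Fin using (Fin; _≟_)
open import Data.Bool using (Bool; true; false; _∨_; _∧_)
open import Data.Product using (_×_; _,_; proj₁; proj₂)
open import Data.List using (List; []; _∷_; map; _++_; length; filter)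
open import Data.Vec using (Vec; []; _∷_; replicate)
open import Data.Fin.Subset using (Subset)
open import Relation.Nullary using (does)
open import Relation.Binary.PropositionalEquality using (_≡_)
open import Data.Fin.Properties using (all?)

fib : ℕ → ℕ
fib zero = 0
fib (suc zero) = 1
fib (suc (suc i)) = fib (suc i) + fib i

-- A (multi)graph on vertex set Fin n with edge set Fin m;
-- edge i has endpoints (proj₁ (G i) , proj₂ (G i)).
Graph : ℕ → ℕ → Set
Graph n m = Fin m → Fin n × Fin n

incident : ∀ {n} → Fin n → Fin n × Fin n → Bool
incident v (a , b) = does (v ≟ a) ∨ does (v ≟ b)

bit : Bool → ℕ
bit true = 1
bit false = 0

countIn : ∀ {m} → Subset m → (Fin m → Bool) → ℕ
countIn {zero} [] p = 0
countIn {suc m} (x ∷ xs) p = bit (x ∧ p Fin.zero) + countIn xs (λ i → p (Fin.suc i))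

degIn : ∀ {n m} → Graph n m → Subset m → Fin n → ℕ
degIn G F v = countIn F (λ i → incident v (G i))

deg : ∀ {n m} → Graph n m → Fin n → ℕ
deg {m = m} G v = degIn G (replicate m true) v

data Reachable {n m} (G : Graph n m) : Fin n → Fin n → Set where
  here : ∀ {v} → Reachable G v v
  fwd  : ∀ {w} (i : Fin m) → Reachable G (proj₂ (G i)) w → Reachable G (proj₁ (G i)) w
  bwd  : ∀ {w} (i : Fin m) → Reachable G (proj₁ (G i)) w → Reachable G (proj₂ (G i)) w

-- G is a tree: connected with (number of vertices) = (number of edges) + 1.
-- (This forces G to be loop-free, without parallel edges, and acyclic.)
IsTree : ∀ {n m} → Graph n m → Set
IsTree {n} {m} G = (suc m ≡ n) × (∀ u v → Reachable G u v)

IsMaxDegree : ∀ {n m} → Graph n m → ℕ → Set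
IsMaxDegree G Δ = (∀ v → deg G v ≤ Δ) × Data.Product.∃ (λ v → deg G v ≡ Δ)

allSubsets : (m : ℕ) → List (Subset m)
allSubsets zero = [] ∷ []
allSubsets (suc m) = map (true ∷_) (allSubsets m) ++ map (false ∷_) (allSubsets m)

-- E_fix(T) = { F ⊆ E | ∀ v, 2 deg_F(v) ≤ deg(v) }, as a list of distinct subsets
Efix : ∀ {n m} → Graph n m → List (Subset m)
Efix G = filter (λ F → all? (λ v → 2 * degIn G F v ≤? deg G v)) (allSubsets _)

-- Relax 2 deg_F(v) ≤ deg(v) to deg_F(v) ≤ c(v) for an arbitrary capacity c and show that there
-- are at most F_{1+Φ} such edge sets F, where Φ = Σ_v min(c(v), deg(v)). Induct on a pendant edge
-- e = ℓu: the sets avoiding e live in T − e, where Φ is smaller by at least one (the term of ℓ);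
-- the sets containing e live in T − e with c(ℓ) and c(u) lowered by one, where Φ is smaller by
-- exactly two; and F_k + F_{k−1} = F_{k+1}. Removing e isolates ℓ, so the induction runs over trees
-- with isolated vertices added. For c = ⌊deg/2⌋ every vertex has degree at least one, whence
-- Φ ≤ Σ ⌊deg/2⌋ = 2(n−1) − Σ ⌈deg/2⌉ ≤ n − 1 − ⌈Δ/2⌉.

module Submission where

open import Defs
open import Data.Nat using (ℕ; _≤_; _∸_; ⌈_/2⌉)
open import Data.List using (length)

open import Data.Bool.Base using (Bool; true; false; _∧_; _∨_)
open import Data.Bool.Properties using (∨-zeroʳ)
open import Data.Fin.Base using (Fin; zero; suc; punchIn; punchOut; fromℕ<)
open import Data.Fin using (_≟_)
open import Data.Fin.Properties using (all?; any?; punchIn-punchOut; punchInᵢ≢i)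
open import Data.Fin.Subset using (Subset)
open import Data.List.Base using (List; []; _∷_; map; _++_; filter)
open import Data.List.Properties using (length-++; filter-++)
open import Data.Nat.Base using (zero; suc; _+_; _*_; _⊓_; _<_; ⌊_/2⌋; z≤n; s≤s; z<s)
open import Data.Nat.Properties hiding (_≟_)
open import Data.Nat.Properties using () renaming (_≟_ to _≟ℕ_)
open import Data.Product using (_×_; _,_; proj₁; proj₂; ∃)
open import Data.Sum using (_⊎_; inj₁; inj₂)
open import Data.Vec.Base using ([]; _∷_; replicate; insertAt)
open import Data.Vec.Functional using (removeAt)
open import Function using (_∘_)
open import Level using (0ℓ)
open import Relation.Nullary using (Dec; yes; no; does; ¬_; contradiction)
open import Relation.Nullary.Decidable using (dec-true; dec-false)
open import Relation.Unary using (Pred; Decidable)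
open import Relation.Binary.PropositionalEquality

open import Algebra.Properties.CommutativeMonoid.Sum +-0-commutativeMonoid
  using (sum; sum-remove; sum-cong-≗; sum-replicate-zero; ∑-distrib-+; ∑-comm)
open import Algebra.Properties.CommutativeSemigroup +-commutativeSemigroup
  using (interchange; x∙yz≈y∙xz)

sum-mono-≤ : ∀ {n} {f g : Fin n → ℕ} → (∀ i → f i ≤ g i) → sum f ≤ sum g
sum-mono-≤ {zero}  f≤g = z≤n
sum-mono-≤ {suc n} f≤g = +-mono-≤ (f≤g zero) (sum-mono-≤ (f≤g ∘ suc))

sum-mono-< : ∀ {n} {f g : Fin n → ℕ} i → f i < g i → (∀ j → f j ≤ g j) → sum f < sum g
sum-mono-< {suc n} {f} {g} i fi<gi f≤g = begin-strict
  sum f                        ≡⟨ sum-remove {i = i} f ⟩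
  f i + sum (removeAt f i)     <⟨ +-mono-<-≤ fi<gi (sum-mono-≤ (f≤g ∘ punchIn i)) ⟩
  g i + sum (removeAt g i)     ≡⟨ sum-remove {i = i} g ⟨
  sum g                        ∎
  where open ≤-Reasoning

sum-mono-≤-except : ∀ {n} {f g : Fin n → ℕ} i → (∀ j → j ≢ i → f j ≤ g j) → sum f ≤ f i + sum g
sum-mono-≤-except {suc n} {f} {g} i f≤g = begin
  sum f                             ≡⟨ sum-remove {i = i} f ⟩
  f i + sum (removeAt f i)          ≤⟨ +-monoʳ-≤ (f i) (sum-mono-≤ λ j → f≤g (punchIn i j) (punchInᵢ≢i i j)) ⟩
  f i + sum (removeAt g i)          ≤⟨ +-monoʳ-≤ (f i) (m≤n+m _ (g i)) ⟩
  f i + (g i + sum (removeAt g i))  ≡⟨ cong (f i +_) (sum-remove {i = i} g) ⟨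
  f i + sum g                       ∎
  where open ≤-Reasoning

sum-ones : ∀ n → sum {n} (λ _ → 1) ≡ n
sum-ones zero    = refl
sum-ones (suc n) = cong suc (sum-ones n)

sum-pos⇒∃ : ∀ {n} (f : Fin n → ℕ) → 0 < sum f → ∃ λ i → 0 < f i
sum-pos⇒∃ {suc n} f pos with f zero in eq
... | suc _ = zero , subst (0 <_) (sym eq) z<s
... | zero  = let i , fi>0 = sum-pos⇒∃ (f ∘ suc) pos in suc i , fi>0

sum≡0⇒≡0 : ∀ {n} (f : Fin (suc n) → ℕ) → sum f ≡ 0 → ∀ i → f i ≡ 0
sum≡0⇒≡0 f eq i = m+n≡0⇒m≡0 (f i) (trans (sym (sum-remove {i = i} f)) eq)

sum-indicator : ∀ {n} (a : Fin n) → sum (λ v → bit (does (v ≟ a))) ≡ 1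
sum-indicator {suc n} a = begin
  sum (λ v → bit (does (v ≟ a)))
    ≡⟨ sum-remove {i = a} (λ v → bit (does (v ≟ a))) ⟩
  bit (does (a ≟ a)) + sum (λ j → bit (does (punchIn a j ≟ a)))
    ≡⟨ cong₂ _+_ self others ⟩
  1 + sum {n} (λ _ → 0)
    ≡⟨ cong suc (sum-replicate-zero n) ⟩
  1 ∎
  where
  open ≡-Reasoning
  self : bit (does (a ≟ a)) ≡ 1
  self = cong bit (dec-true (a ≟ a) refl)
  others : sum (λ j → bit (does (punchIn a j ≟ a))) ≡ sum {n} (λ _ → 0)
  others = sum-cong-≗ (λ j → cong bit (dec-false (punchIn a j ≟ a) (punchInᵢ≢i a j)))

fib-≤-suc : ∀ k → fib k ≤ fib (suc k)
fib-≤-suc zero          = z≤n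
fib-≤-suc (suc zero)    = ≤-refl
fib-≤-suc (suc (suc k)) = m≤m+n _ _

fib-mono : ∀ {a b} → a ≤ b → fib a ≤ fib b
fib-mono {b = zero}  z≤n = ≤-refl
fib-mono {b = suc b} a≤b with m≤n⇒m<n∨m≡n a≤b
... | inj₁ (s≤s a≤b′) = ≤-trans (fib-mono a≤b′) (fib-≤-suc b)
... | inj₂ refl       = ≤-refl

fib-+-≤ : ∀ {a b k} → suc a ≤ k → suc (suc b) ≤ k → fib a + fib b ≤ fib k
fib-+-≤ {k = suc (suc k)} (s≤s a≤) (s≤s (s≤s b≤)) = +-mono-≤ (fib-mono a≤) (fib-mono b≤)

incident-proj₁ : ∀ {n} (p : Fin n × Fin n) → incident (proj₁ p) p ≡ true
incident-proj₁ (a , b) = cong (_∨ does (a ≟ b)) (dec-true (a ≟ a) refl)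

incident-proj₂ : ∀ {n} (p : Fin n × Fin n) → incident (proj₂ p) p ≡ true
incident-proj₂ (a , b) = trans (cong (does (b ≟ a) ∨_) (dec-true (b ≟ b) refl)) (∨-zeroʳ _)

incident-bit-≤ : ∀ {n} (v a b : Fin n) →
                 bit (incident v (a , b)) ≤ bit (does (v ≟ a)) + bit (does (v ≟ b))
incident-bit-≤ v a b with does (v ≟ a) | does (v ≟ b)
... | true  | _     = s≤s z≤n
... | false | true  = s≤s z≤n
... | false | false = z≤n

incident-bit-≡ : ∀ {n} {a b : Fin n} → a ≢ b → ∀ v →
                 bit (incident v (a , b)) ≡ bit (does (v ≟ a)) + bit (does (v ≟ b))
incident-bit-≡ {a = a} {b} a≢b v with v ≟ a | v ≟ b
... | yes refl | yes refl = contradiction refl a≢b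
... | yes _    | no _     = refl
... | no _     | yes _    = refl
... | no _     | no _     = refl

sum-indicator-pair : ∀ {n} (a b : Fin n) → sum (λ v → bit (does (v ≟ a)) + bit (does (v ≟ b))) ≡ 2
sum-indicator-pair a b =
  trans (∑-distrib-+ (λ v → bit (does (v ≟ a))) _) (cong₂ _+_ (sum-indicator a) (sum-indicator b))

sum-incident-≤ : ∀ {n} (p : Fin n × Fin n) → sum (λ v → bit (incident v p)) ≤ 2
sum-incident-≤ (a , b) =
  ≤-trans (sum-mono-≤ (λ v → incident-bit-≤ v a b)) (≤-reflexive (sum-indicator-pair a b))

sum-incident-≡ : ∀ {n} (p : Fin n × Fin n) → proj₁ p ≢ proj₂ p → sum (λ v → bit (incident v p)) ≡ 2
sum-incident-≡ (a , b) a≢b = trans (sum-cong-≗ (incident-bit-≡ a≢b)) (sum-indicator-pair a b)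

countIn-replicate : ∀ {m} (p : Fin m → Bool) → countIn (replicate m true) p ≡ sum (bit ∘ p)
countIn-replicate {zero}  p = refl
countIn-replicate {suc m} p = cong (bit (p zero) +_) (countIn-replicate (p ∘ suc))

countIn-insertAt : ∀ {m} (F : Subset m) e b (p : Fin (suc m) → Bool) →
                   countIn (insertAt F e b) p ≡ bit (b ∧ p e) + countIn F (p ∘ punchIn e)
countIn-insertAt F       zero    b p = refl
countIn-insertAt (x ∷ F) (suc e) b p =
  trans (cong (bit (x ∧ p zero) +_) (countIn-insertAt F e b (p ∘ suc)))
        (x∙yz≈y∙xz (bit (x ∧ p zero)) (bit (b ∧ p (suc e))) _)

deg≡sum : ∀ {n m} (G : Graph n m) v → deg G v ≡ sum (λ i → bit (incident v (G i)))
deg≡sum G v = countIn-replicate (λ i → incident v (G i))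

deg-removeAt : ∀ {n m} (G : Graph n (suc m)) e v → deg G v ≡ bit (incident v (G e)) + deg (removeAt G e) v
deg-removeAt G e v = begin
  deg G v
    ≡⟨ deg≡sum G v ⟩
  sum (λ i → bit (incident v (G i)))
    ≡⟨ sum-remove {i = e} (λ i → bit (incident v (G i))) ⟩
  bit (incident v (G e)) + sum (λ j → bit (incident v (removeAt G e j)))
    ≡⟨ cong (bit (incident v (G e)) +_) (deg≡sum (removeAt G e) v) ⟨
  bit (incident v (G e)) + deg (removeAt G e) v ∎
  where open ≡-Reasoning

deg-removeAt-incident : ∀ {n m} (G : Graph n (suc m)) e {v} → incident v (G e) ≡ true →
                        deg G v ≡ suc (deg (removeAt G e) v)
deg-removeAt-incident G e {v} inc =
  trans (deg-removeAt G e v) (cong (λ b → bit b + deg (removeAt G e) v) inc)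

deg-removeAt-¬incident : ∀ {n m} (G : Graph n (suc m)) e {v} → incident v (G e) ≡ false →
                         deg G v ≡ deg (removeAt G e) v
deg-removeAt-¬incident G e {v} ¬inc =
  trans (deg-removeAt G e v) (cong (λ b → bit b + deg (removeAt G e) v) ¬inc)

deg-removeAt-≤ : ∀ {n m} (G : Graph n (suc m)) e v → deg (removeAt G e) v ≤ deg G v
deg-removeAt-≤ G e v = subst (deg (removeAt G e) v ≤_) (sym (deg-removeAt G e v)) (m≤n+m _ _)

degIn-insertAt : ∀ {n m} (G : Graph n (suc m)) F e b v →
                 degIn G (insertAt F e b) v ≡ bit (b ∧ incident v (G e)) + degIn (removeAt G e) F v
degIn-insertAt G F e b v = countIn-insertAt F e b (λ i → incident v (G i))

incident⇒deg-pos : ∀ {n m} (G : Graph n m) i v → incident v (G i) ≡ true → 0 < deg G v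
incident⇒deg-pos {m = suc m} G i v inc = subst (0 <_) (sym (deg-removeAt-incident G i {v} inc)) z<s

deg-pos⇒incident : ∀ {n m} (G : Graph n m) {v} → 0 < deg G v → ∃ λ i → incident v (G i) ≡ true
deg-pos⇒incident G {v} pos
  with sum-pos⇒∃ (λ i → bit (incident v (G i))) (subst (0 <_) (deg≡sum G v) pos)
... | i , bit>0 = i , bit-pos bit>0
  where
  bit-pos : ∀ {b} → 0 < bit b → b ≡ true
  bit-pos {true} _ = refl

deg≡0⇒¬incident : ∀ {n m} (G : Graph n m) {v} → deg G v ≡ 0 → ∀ i → incident v (G i) ≡ false
deg≡0⇒¬incident {m = suc m} G {v} deg≡0 i =
  bit≡0 (sum≡0⇒≡0 (λ i → bit (incident v (G i))) (trans (sym (deg≡sum G v)) deg≡0) i)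
  where
  bit≡0 : ∀ {b} → bit b ≡ 0 → b ≡ false
  bit≡0 {false} _ = refl

handshake : ∀ {n m} (G : Graph n m) → sum (deg G) ≤ m + m
handshake {m = m} G = begin
  sum (deg G)                                        ≡⟨ sum-cong-≗ (deg≡sum G) ⟩
  sum (λ v → sum (λ i → bit (incident v (G i))))     ≡⟨ ∑-comm (λ v i → bit (incident v (G i))) ⟩
  sum (λ i → sum (λ v → bit (incident v (G i))))     ≤⟨ sum-mono-≤ (λ i → sum-incident-≤ (G i)) ⟩
  sum {m} (λ _ → 1 + 1)                              ≡⟨ ∑-distrib-+ {m} (λ _ → 1) (λ _ → 1) ⟩
  sum {m} (λ _ → 1) + sum {m} (λ _ → 1)              ≡⟨ cong₂ _+_ (sum-ones m) (sum-ones m) ⟩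
  m + m                                              ∎
  where open ≤-Reasoning

-- Counting edge sets

countSubsets : ∀ m {P : Pred (Subset m) 0ℓ} → Decidable P → ℕ
countSubsets zero    P? = bit (does (P? []))
countSubsets (suc m) P? = countSubsets m (λ F → P? (true ∷ F)) + countSubsets m (λ F → P? (false ∷ F))

length-filter-map : ∀ {A B : Set} {P : Pred B 0ℓ} (P? : Decidable P) (f : A → B) (xs : List A) →
                    length (filter P? (map f xs)) ≡ length (filter (P? ∘ f) xs)
length-filter-map P? f []       = refl
length-filter-map P? f (x ∷ xs) with does (P? (f x))
... | true  = cong suc (length-filter-map P? f xs)
... | false = length-filter-map P? f xs

length-filter-allSubsets : ∀ m {P : Pred (Subset m) 0ℓ} (P? : Decidable P) →
                           length (filter P? (allSubsets m)) ≡ countSubsets m P?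
length-filter-allSubsets zero P? with does (P? [])
... | true  = refl
... | false = refl
length-filter-allSubsets (suc m) P? = begin
  length (filter P? (map (true ∷_) S ++ map (false ∷_) S))
    ≡⟨ cong length (filter-++ P? (map (true ∷_) S) (map (false ∷_) S)) ⟩
  length (filter P? (map (true ∷_) S) ++ filter P? (map (false ∷_) S))
    ≡⟨ length-++ (filter P? (map (true ∷_) S)) ⟩
  length (filter P? (map (true ∷_) S)) + length (filter P? (map (false ∷_) S))
    ≡⟨ cong₂ _+_ (length-filter-map P? (true ∷_) S) (length-filter-map P? (false ∷_) S) ⟩
  length (filter (λ F → P? (true ∷ F)) S) + length (filter (λ F → P? (false ∷ F)) S)
    ≡⟨ cong₂ _+_ (length-filter-allSubsets m _) (length-filter-allSubsets m _) ⟩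
  countSubsets (suc m) P? ∎
  where
  open ≡-Reasoning
  S = allSubsets m

countSubsets-mono : ∀ m {P Q : Pred (Subset m) 0ℓ} (P? : Decidable P) (Q? : Decidable Q) →
                    (∀ F → P F → Q F) → countSubsets m P? ≤ countSubsets m Q?
countSubsets-mono zero P? Q? P⇒Q with P? [] | Q? []
... | yes p | yes _ = ≤-refl
... | yes p | no ¬q = contradiction (P⇒Q [] p) ¬q
... | no _  | _     = z≤n
countSubsets-mono (suc m) P? Q? P⇒Q =
  +-mono-≤ (countSubsets-mono m _ _ (λ F → P⇒Q (true ∷ F)))
           (countSubsets-mono m _ _ (λ F → P⇒Q (false ∷ F)))

countSubsets-none : ∀ m {P : Pred (Subset m) 0ℓ} (P? : Decidable P) → (∀ F → ¬ P F) →
                    countSubsets m P? ≡ 0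
countSubsets-none zero    P? ¬P = cong bit (dec-false (P? []) (¬P []))
countSubsets-none (suc m) P? ¬P =
  cong₂ _+_ (countSubsets-none m _ (λ F → ¬P (true ∷ F)))
            (countSubsets-none m _ (λ F → ¬P (false ∷ F)))

countSubsets-insertAt : ∀ m {P : Pred (Subset (suc m)) 0ℓ} (P? : Decidable P) e →
  countSubsets (suc m) P? ≡
    countSubsets m (λ F → P? (insertAt F e true)) + countSubsets m (λ F → P? (insertAt F e false))
countSubsets-insertAt m       P? zero    = refl
countSubsets-insertAt (suc m) P? (suc e) =
  trans (cong₂ _+_ (countSubsets-insertAt m (λ F → P? (true ∷ F)) e)
                   (countSubsets-insertAt m (λ F → P? (false ∷ F)) e))
        (interchange (countSubsets m (λ F → P? (true ∷ insertAt F e true)))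
                     (countSubsets m (λ F → P? (true ∷ insertAt F e false)))
                     (countSubsets m (λ F → P? (false ∷ insertAt F e true)))
                     (countSubsets m (λ F → P? (false ∷ insertAt F e false))))

WithinCapacity : ∀ {n m} → Graph n m → (Fin n → ℕ) → Subset m → Set
WithinCapacity G c F = ∀ v → degIn G F v ≤ c v

withinCapacity? : ∀ {n m} (G : Graph n m) c → Decidable (WithinCapacity G c)
withinCapacity? G c F = all? (λ v → degIn G F v ≤? c v)

countWithin : ∀ {n m} → Graph n m → (Fin n → ℕ) → ℕ
countWithin {m = m} G c = countSubsets m (withinCapacity? G c)

Fits : ∀ {n} → Fin n × Fin n → (Fin n → ℕ) → Set
Fits p c = ∀ v → bit (incident v p) ≤ c v

fits? : ∀ {n} (p : Fin n × Fin n) c → Dec (Fits p c)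
fits? p c = all? (λ v → bit (incident v p) ≤? c v)

infixl 6 _∸ₑ_
_∸ₑ_ : ∀ {n} → (Fin n → ℕ) → Fin n × Fin n → Fin n → ℕ
(c ∸ₑ p) v = c v ∸ bit (incident v p)

module _ {n m} (G : Graph n (suc m)) (c : Fin n → ℕ) (e : Fin (suc m)) where

  private
    G′ = removeAt G e
    withE : Decidable (λ F → WithinCapacity G c (insertAt F e true))
    withE F = withinCapacity? G c (insertAt F e true)
    withoutE : Decidable (λ F → WithinCapacity G c (insertAt F e false))
    withoutE F = withinCapacity? G c (insertAt F e false)

  withinCapacity-without : ∀ F → WithinCapacity G c (insertAt F e false) → WithinCapacity G′ c F
  withinCapacity-without F within v = subst (_≤ c v) (degIn-insertAt G F e false v) (within v)

  withinCapacity-with : ∀ F → WithinCapacity G c (insertAt F e true) →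
                        Fits (G e) c × WithinCapacity G′ (c ∸ₑ G e) F
  withinCapacity-with F within =
    (λ v → m+n≤o⇒m≤o _ (bound v)) ,
    (λ v → m+n≤o⇒m≤o∸n _ (subst (_≤ c v) (+-comm (bit (incident v (G e))) _) (bound v)))
    where
    bound : ∀ v → bit (incident v (G e)) + degIn G′ F v ≤ c v
    bound v = subst (_≤ c v) (degIn-insertAt G F e true v) (within v)

  countWithin-removeAt : countWithin G c ≤ countWithin G′ c + countWithin G′ (c ∸ₑ G e)
  countWithin-removeAt = begin
    countWithin G c
      ≡⟨ countSubsets-insertAt m (withinCapacity? G c) e ⟩
    countSubsets m withE + countSubsets m withoutE
      ≡⟨ +-comm (countSubsets m withE) _ ⟩
    countSubsets m withoutE + countSubsets m withE
      ≤⟨ +-mono-≤ (countSubsets-mono m withoutE _ withinCapacity-without)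
                  (countSubsets-mono m withE _ (λ F → proj₂ ∘ withinCapacity-with F)) ⟩
    countWithin G′ c + countWithin G′ (c ∸ₑ G e) ∎
    where open ≤-Reasoning

  countWithin-removeAt-¬fits : ¬ Fits (G e) c → countWithin G c ≤ countWithin G′ c
  countWithin-removeAt-¬fits ¬fits = begin
    countWithin G c
      ≡⟨ countSubsets-insertAt m (withinCapacity? G c) e ⟩
    countSubsets m withE + countSubsets m withoutE
      ≡⟨ cong (_+ countSubsets m withoutE) withE-none ⟩
    countSubsets m withoutE
      ≤⟨ countSubsets-mono m withoutE _ withinCapacity-without ⟩
    countWithin G′ c ∎
    where
    open ≤-Reasoning
    withE-none : countSubsets m withE ≡ 0
    withE-none = countSubsets-none m withE (λ F → ¬fits ∘ proj₁ ∘ withinCapacity-with F)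

potential : ∀ {n m} → Graph n m → (Fin n → ℕ) → ℕ
potential G c = sum (λ v → c v ⊓ deg G v)

m+[n∸m]⊓o≡n⊓[m+o] : ∀ {m n} o → m ≤ n → m + (n ∸ m) ⊓ o ≡ n ⊓ (m + o)
m+[n∸m]⊓o≡n⊓[m+o] {m} {n} o m≤n =
  trans (+-distribˡ-⊓ m (n ∸ m) o) (cong (_⊓ (m + o)) (m+[n∸m]≡n m≤n))

module _ {n m} (G : Graph n (suc m)) (c : Fin n → ℕ) (e : Fin (suc m)) where

  private
    G′ = removeAt G e

  potential-removeAt-≤ : potential G′ c ≤ potential G c
  potential-removeAt-≤ = sum-mono-≤ (λ v → ⊓-monoʳ-≤ (c v) (deg-removeAt-≤ G e v))

  potential-removeAt-leaf : ∀ {ℓ} → incident ℓ (G e) ≡ true → deg G′ ℓ ≡ 0 → 0 < c ℓ →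
                            potential G′ c < potential G c
  potential-removeAt-leaf {ℓ} inc isolated cℓ>0 =
    sum-mono-< ℓ (subst (λ d → c ℓ ⊓ d < c ℓ ⊓ deg G ℓ) (sym isolated) leaf-term)
                 (λ v → ⊓-monoʳ-≤ (c v) (deg-removeAt-≤ G e v))
    where
    leaf-term : c ℓ ⊓ 0 < c ℓ ⊓ deg G ℓ
    leaf-term = subst (_< c ℓ ⊓ deg G ℓ) (sym (⊓-zeroʳ (c ℓ)))
                      (⊓-pres-m< cℓ>0 (incident⇒deg-pos G e ℓ inc))

  potential-removeAt-spend : proj₁ (G e) ≢ proj₂ (G e) → Fits (G e) c →
                             2 + potential G′ (c ∸ₑ G e) ≡ potential G c
  potential-removeAt-spend loopless fits = begin
    2 + potential G′ (c ∸ₑ G e)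
      ≡⟨ cong (_+ potential G′ (c ∸ₑ G e)) (sum-incident-≡ (G e) loopless) ⟨
    sum (λ v → bit (incident v (G e))) + potential G′ (c ∸ₑ G e)
      ≡⟨ ∑-distrib-+ (λ v → bit (incident v (G e))) _ ⟨
    sum (λ v → bit (incident v (G e)) + (c ∸ₑ G e) v ⊓ deg G′ v)
      ≡⟨ sum-cong-≗ pointwise ⟩
    potential G c ∎
    where
    open ≡-Reasoning
    pointwise : ∀ v → bit (incident v (G e)) + (c ∸ₑ G e) v ⊓ deg G′ v ≡ c v ⊓ deg G v
    pointwise v = trans (m+[n∸m]⊓o≡n⊓[m+o] (deg G′ v) (fits v))
                        (cong (c v ⊓_) (sym (deg-removeAt G e v)))


Reachable-active : ∀ {n m} (G : Graph n m) {x y} → Reachable G x y → x ≢ y → 0 < deg G x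
Reachable-active G here      x≢x = contradiction refl x≢x
Reachable-active G (fwd i _) _   = incident⇒deg-pos G i (proj₁ (G i)) (incident-proj₁ (G i))
Reachable-active G (bwd i _) _   = incident⇒deg-pos G i (proj₂ (G i)) (incident-proj₂ (G i))

active≢isolated : ∀ {n m} (G : Graph n m) a b → 0 < deg G a → deg G b ≡ 0 → a ≢ b
active≢isolated G a b a-active b-isolated refl = <⇒≢ a-active (sym b-isolated)

module _ {n m n′ m′} {G : Graph n m} {H : Graph n′ m′} (r : Fin n → Fin n′)
         (edge-image : ∀ i → r (proj₁ (G i)) ≡ r (proj₂ (G i))
                           ⊎ ∃ λ j → H j ≡ (r (proj₁ (G i)) , r (proj₂ (G i)))) where

  Reachable-map : ∀ {x y} → Reachable G x y → Reachable H (r x) (r y)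
  Reachable-map here = here
  Reachable-map {y = y} (fwd i w) with edge-image i
  ... | inj₁ eq       = subst (λ z → Reachable H z (r y)) (sym eq) (Reachable-map w)
  ... | inj₂ (j , eq) = subst (λ p → Reachable H (proj₁ p) (r y)) eq
                          (fwd j (subst (λ p → Reachable H (proj₂ p) (r y)) (sym eq)
                                        (Reachable-map w)))
  Reachable-map {y = y} (bwd i w) with edge-image i
  ... | inj₁ eq       = subst (λ z → Reachable H z (r y)) eq (Reachable-map w)
  ... | inj₂ (j , eq) = subst (λ p → Reachable H (proj₂ p) (r y)) eq
                          (bwd j (subst (λ p → Reachable H (proj₁ p) (r y)) (sym eq)
                                        (Reachable-map w)))

Ends : ∀ {n} → Fin n × Fin n → Fin n → Fin n → Set
Ends p ℓ u = p ≡ (ℓ , u) ⊎ p ≡ (u , ℓ)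

incident⇒Ends : ∀ {n} {v : Fin n} p → incident v p ≡ true → ∃ (Ends p v)
incident⇒Ends {v = v} (a , b) inc with v ≟ a | v ≟ b
incident⇒Ends (a , b) inc  | yes refl | _        = b , inj₁ refl
incident⇒Ends (a , b) inc  | no _     | yes refl = a , inj₂ refl
incident⇒Ends (a , b) ()   | no _     | no _

Ends-incident : ∀ {n} {p : Fin n × Fin n} {ℓ u} → Ends p ℓ u → incident ℓ p ≡ true
Ends-incident {p = p} (inj₁ refl) = incident-proj₁ p
Ends-incident {p = p} (inj₂ refl) = incident-proj₂ p

Ends-¬incident : ∀ {n} {p : Fin n × Fin n} {ℓ u v} → Ends p ℓ u → v ≢ ℓ → v ≢ u →
                 incident v p ≡ false
Ends-¬incident {v = v} (inj₁ refl) v≢ℓ v≢u = cong₂ _∨_ (dec-false (v ≟ _) v≢ℓ) (dec-false (v ≟ _) v≢u)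
Ends-¬incident {v = v} (inj₂ refl) v≢ℓ v≢u = cong₂ _∨_ (dec-false (v ≟ _) v≢u) (dec-false (v ≟ _) v≢ℓ)

Ends-loopless : ∀ {n} {p : Fin n × Fin n} {ℓ u} → Ends p ℓ u → ℓ ≢ u → proj₁ p ≢ proj₂ p
Ends-loopless (inj₁ refl) ℓ≢u = ℓ≢u
Ends-loopless (inj₂ refl) ℓ≢u = ℓ≢u ∘ sym

collapse : ∀ {n} → Fin n → Fin n → Fin n → Fin n
collapse ℓ u x with x ≟ ℓ
... | yes _ = u
... | no _  = x

collapse-leaf : ∀ {n} (ℓ u : Fin n) → collapse ℓ u ℓ ≡ u
collapse-leaf ℓ u with ℓ ≟ ℓ
... | yes _   = refl
... | no ℓ≢ℓ  = contradiction refl ℓ≢ℓ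

collapse-other : ∀ {n} (ℓ u : Fin n) → collapse ℓ u u ≡ u
collapse-other ℓ u with u ≟ ℓ
... | yes _ = refl
... | no _  = refl

collapse-≢ : ∀ {n} (ℓ u : Fin n) {x} → x ≢ ℓ → collapse ℓ u x ≡ x
collapse-≢ ℓ u {x} x≢ℓ with x ≟ ℓ
... | yes x≡ℓ = contradiction x≡ℓ x≢ℓ
... | no _    = refl

collapse-Ends : ∀ {n} {p : Fin n × Fin n} {ℓ u} → Ends p ℓ u →
                collapse ℓ u (proj₁ p) ≡ collapse ℓ u (proj₂ p)
collapse-Ends {ℓ = ℓ} {u} (inj₁ refl) = trans (collapse-leaf ℓ u) (sym (collapse-other ℓ u))
collapse-Ends {ℓ = ℓ} {u} (inj₂ refl) = trans (collapse-other ℓ u) (sym (collapse-leaf ℓ u))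

collapse-¬incident : ∀ {n} {p : Fin n × Fin n} {ℓ} u → incident ℓ p ≡ false →
                     (collapse ℓ u (proj₁ p) , collapse ℓ u (proj₂ p)) ≡ p
collapse-¬incident {p = p} {ℓ} u ¬inc =
  cong₂ _,_ (collapse-≢ ℓ u λ { refl → contradiction (trans (sym (incident-proj₁ p)) ¬inc) λ () })
            (collapse-≢ ℓ u λ { refl → contradiction (trans (sym (incident-proj₂ p)) ¬inc) λ () })

-- Trees with isolated vertices, and their pendant edges

#active : ∀ {n m} → Graph n m → ℕ
#active G = sum (λ v → 1 ⊓ deg G v)

1⊓-pos : ∀ {d} → 0 < d → 1 ⊓ d ≡ 1
1⊓-pos {suc d} _ = refl

1⊓-pos⁻¹ : ∀ {d} → 0 < 1 ⊓ d → 0 < d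
1⊓-pos⁻¹ {suc d} _ = z<s

∃deg≡1 : ∀ {n m} (G : Graph n m) → m < #active G → ∃ λ v → deg G v ≡ 1
∃deg≡1 {m = m} G m<#active with any? (λ v → deg G v ≟ℕ 1)
... | yes found = found
... | no none   = contradiction (handshake G) (<⇒≱ (begin-strict
  m + m                                  <⟨ +-mono-< m<#active m<#active ⟩
  #active G + #active G                  ≡⟨ ∑-distrib-+ (λ v → 1 ⊓ deg G v) _ ⟨
  sum (λ v → 1 ⊓ deg G v + 1 ⊓ deg G v)  ≤⟨ sum-mono-≤ (λ v → twice-1⊓d≤d (deg G v) (none ∘ (v ,_))) ⟩
  sum (deg G)                            ∎))
  where
  open ≤-Reasoning
  twice-1⊓d≤d : ∀ d → d ≢ 1 → 1 ⊓ d + 1 ⊓ d ≤ d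
  twice-1⊓d≤d zero          _   = z≤n
  twice-1⊓d≤d (suc zero)    d≢1 = contradiction refl d≢1
  twice-1⊓d≤d (suc (suc d)) _   = s≤s (s≤s z≤n)

another-active : ∀ {n m} (G : Graph n m) → 1 < #active G → ∀ ℓ → ∃ λ w → w ≢ ℓ × 0 < deg G w
another-active {suc n} G 1<#active ℓ =
  let j , pos = sum-pos⇒∃ (removeAt (λ v → 1 ⊓ deg G v) ℓ) (+-cancelˡ-≤ 1 _ _ (begin
        2                                                  ≤⟨ 1<#active ⟩
        #active G                                          ≡⟨ sum-remove {i = ℓ} (λ v → 1 ⊓ deg G v) ⟩
        1 ⊓ deg G ℓ + sum (removeAt (λ v → 1 ⊓ deg G v) ℓ) ≤⟨ +-monoˡ-≤ _ (m⊓n≤m 1 (deg G ℓ)) ⟩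
        1 + sum (removeAt (λ v → 1 ⊓ deg G v) ℓ)           ∎))
  in punchIn ℓ j , punchInᵢ≢i ℓ j , 1⊓-pos⁻¹ pos
  where open ≤-Reasoning

record IsTreeUpToIsolated {n m} (G : Graph n m) : Set where
  field
    connected : ∀ {a b} → 0 < deg G a → 0 < deg G b → Reachable G a b
    spanning  : 0 < m → suc m ≤ #active G

record Pendant {n m} (G : Graph n (suc m)) : Set where
  field
    edge          : Fin (suc m)
    leaf other    : Fin n
    ends          : Ends (G edge) leaf other
    leaf-isolated : deg (removeAt G edge) leaf ≡ 0

findPendant : ∀ {n m} (G : Graph n (suc m)) → suc m < #active G → Pendant G
findPendant G m<#active =
  let ℓ , degℓ≡1 = ∃deg≡1 G m<#active
      e , inc     = deg-pos⇒incident G {ℓ} (≤-reflexive (sym degℓ≡1))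
      u , ends    = incident⇒Ends (G e) inc
  in record { edge = e ; leaf = ℓ ; other = u ; ends = ends
            ; leaf-isolated = suc-injective (trans (sym (deg-removeAt-incident G e {ℓ} inc)) degℓ≡1) }

module PendantRemoval {n m} {G : Graph n (suc m)} (tree : IsTreeUpToIsolated G) (P : Pendant G) where

  open IsTreeUpToIsolated tree
  open Pendant P

  G′ : Graph n m
  G′ = removeAt G edge

  leaf-active : 0 < deg G leaf
  leaf-active = incident⇒deg-pos G edge leaf (Ends-incident ends)

  reachable-removeAt : ∀ {x y} → Reachable G x y →
                       Reachable G′ (collapse leaf other x) (collapse leaf other y)
  reachable-removeAt = Reachable-map r edge-image
    where
    r = collapse leaf other
    edge-image : ∀ i → r (proj₁ (G i)) ≡ r (proj₂ (G i))
                     ⊎ ∃ λ j → G′ j ≡ (r (proj₁ (G i)) , r (proj₂ (G i)))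
    edge-image i with i ≟ edge
    ... | yes refl = inj₁ (collapse-Ends ends)
    ... | no i≢e   = inj₂ (j , trans G′j≡Gi (sym (collapse-¬incident other ¬inc)))
      where
      j = punchOut (i≢e ∘ sym)
      G′j≡Gi : G′ j ≡ G i
      G′j≡Gi = cong G (punchIn-punchOut (i≢e ∘ sym))
      ¬inc : incident leaf (G i) ≡ false
      ¬inc = subst (λ p → incident leaf p ≡ false) G′j≡Gi (deg≡0⇒¬incident G′ {leaf} leaf-isolated j)

  reach-other : ∀ {w} → 0 < deg G w → w ≢ leaf → Reachable G′ other w
  reach-other {w} w-active w≢ℓ =
    subst₂ (Reachable G′) (collapse-leaf leaf other) (collapse-≢ leaf other w≢ℓ)
           (reachable-removeAt (connected {leaf} {w} leaf-active w-active))

  -- A loop would make `other` the isolated leaf itself, which `reach-other` joins to an active vertex.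
  nonLoop : leaf ≢ other
  nonLoop ℓ≡u =
    let w , w≢ℓ , w-active = another-active G (≤-trans (s≤s (s≤s z≤n)) (spanning z<s)) leaf
        u-active = Reachable-active G′ (reach-other w-active w≢ℓ) (λ u≡w → w≢ℓ (sym (trans ℓ≡u u≡w)))
    in active≢isolated G′ other leaf u-active leaf-isolated (sym ℓ≡u)

  -- In G′, `other` is joined to the endpoint of any remaining edge.
  other-active : 0 < m → 0 < deg G′ other
  other-active 0<m = by-cases (other ≟ a)
    where
    a = proj₁ (G′ (fromℕ< 0<m))
    a-active : 0 < deg G′ a
    a-active = incident⇒deg-pos G′ (fromℕ< 0<m) a (incident-proj₁ (G′ (fromℕ< 0<m)))
    a≢ℓ : a ≢ leaf
    a≢ℓ = active≢isolated G′ a leaf a-active leaf-isolated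
    by-cases : Dec (other ≡ a) → 0 < deg G′ other
    by-cases (yes u≡a) = subst (λ x → 0 < deg G′ x) (sym u≡a) a-active
    by-cases (no u≢a)  =
      Reachable-active G′ (reach-other (≤-trans a-active (deg-removeAt-≤ G edge a)) a≢ℓ) u≢a

  #active-removeAt : 0 < m → #active G ≤ suc (#active G′)
  #active-removeAt 0<m = begin
    #active G                       ≤⟨ sum-mono-≤-except leaf pointwise ⟩
    1 ⊓ deg G leaf + #active G′     ≤⟨ +-monoˡ-≤ (#active G′) (m⊓n≤m 1 (deg G leaf)) ⟩
    suc (#active G′)                ∎
    where
    open ≤-Reasoning
    pointwise : ∀ v → v ≢ leaf → 1 ⊓ deg G v ≤ 1 ⊓ deg G′ v
    pointwise v v≢ℓ with v ≟ other
    ... | yes refl = ≤-trans (m⊓n≤m 1 (deg G v)) (≤-reflexive (sym (1⊓-pos (other-active 0<m))))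
    ... | no v≢u   =
      ≤-reflexive (cong (1 ⊓_) (deg-removeAt-¬incident G edge {v} (Ends-¬incident ends v≢ℓ v≢u)))

  removePendant : IsTreeUpToIsolated G′
  removePendant = record
    { connected = λ {a} {b} a-active b-active →
        subst₂ (Reachable G′) (fixed a a-active) (fixed b b-active)
               (reachable-removeAt (connected {a} {b} (lift a a-active) (lift b b-active)))
    ; spanning = λ 0<m → ≤-pred (≤-trans (spanning z<s) (#active-removeAt 0<m))
    }
    where
    lift : ∀ v → 0 < deg G′ v → 0 < deg G v
    lift v pos = ≤-trans pos (deg-removeAt-≤ G edge v)
    fixed : ∀ v → 0 < deg G′ v → collapse leaf other v ≡ v
    fixed v pos = collapse-≢ leaf other (active≢isolated G′ v leaf pos leaf-isolated)

countWithin≤fib : ∀ {n m} (G : Graph n m) c → IsTreeUpToIsolated G →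
                  countWithin G c ≤ fib (suc (potential G c))
countWithin≤fib {m = zero}  G c _    = ≤-trans (bit≤1 _) (fib-mono {1} {suc (potential G c)} (s≤s z≤n))
  where
  bit≤1 : ∀ b → bit b ≤ 1
  bit≤1 true  = ≤-refl
  bit≤1 false = z≤n
countWithin≤fib {m = suc m} G c tree =
  viaPendant (findPendant G (IsTreeUpToIsolated.spanning tree z<s))
  where
  viaPendant : Pendant G → countWithin G c ≤ fib (suc (potential G c))
  viaPendant P = by-cases (fits? (G edge) c)
    where
    open Pendant P
    open PendantRemoval tree P
    open ≤-Reasoning
    ih : ∀ c′ → countWithin G′ c′ ≤ fib (suc (potential G′ c′))
    ih c′ = countWithin≤fib G′ c′ removePendant
    by-cases : Dec (Fits (G edge) c) → countWithin G c ≤ fib (suc (potential G c))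
    by-cases (yes fits) = begin
      countWithin G c
        ≤⟨ countWithin-removeAt G c edge ⟩
      countWithin G′ c + countWithin G′ (c ∸ₑ G edge)
        ≤⟨ +-mono-≤ (ih c) (ih (c ∸ₑ G edge)) ⟩
      fib (suc (potential G′ c)) + fib (suc (potential G′ (c ∸ₑ G edge)))
        ≤⟨ fib-+-≤ (s≤s (potential-removeAt-leaf G c edge (Ends-incident ends) leaf-isolated leaf-fits))
                   (s≤s (≤-reflexive spend)) ⟩
      fib (suc (potential G c)) ∎
      where
      leaf-fits : 0 < c leaf
      leaf-fits = subst (λ b → bit b ≤ c leaf) (Ends-incident ends) (fits leaf)
      spend : 2 + potential G′ (c ∸ₑ G edge) ≡ potential G c
      spend = potential-removeAt-spend G c edge (Ends-loopless ends nonLoop) fits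
    by-cases (no ¬fits) = begin
      countWithin G c              ≤⟨ countWithin-removeAt-¬fits G c edge ¬fits ⟩
      countWithin G′ c             ≤⟨ ih c ⟩
      fib (suc (potential G′ c))   ≤⟨ fib-mono (s≤s (potential-removeAt-≤ G c edge)) ⟩
      fib (suc (potential G c))    ∎

halfDeg : ∀ {n m} → Graph n m → Fin n → ℕ
halfDeg G v = ⌊ deg G v /2⌋

2*m≤n⇒m≤⌊n/2⌋ : ∀ {m n} → 2 * m ≤ n → m ≤ ⌊ n /2⌋
2*m≤n⇒m≤⌊n/2⌋ {m} {n} 2m≤n =
  subst (_≤ ⌊ n /2⌋) (sym (n≡⌊n+n/2⌋ m))
        (⌊n/2⌋-mono (subst (_≤ n) (cong (m +_) (+-identityʳ m)) 2m≤n))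

length-Efix≤countWithin : ∀ {n m} (T : Graph n m) → length (Efix T) ≤ countWithin T (halfDeg T)
length-Efix≤countWithin {m = m} T = begin
  length (Efix T)          ≡⟨ length-filter-allSubsets m fixed? ⟩
  countSubsets m fixed?    ≤⟨ countSubsets-mono m fixed? (withinCapacity? T (halfDeg T))
                                (λ F 2deg≤deg v → 2*m≤n⇒m≤⌊n/2⌋ (2deg≤deg v)) ⟩
  countWithin T (halfDeg T) ∎
  where
  open ≤-Reasoning
  fixed? : Decidable (λ F → ∀ v → 2 * degIn T F v ≤ deg T v)
  fixed? F = all? (λ v → 2 * degIn T F v ≤? deg T v)

IsTree⇒IsTreeUpToIsolated : ∀ {n m} (T : Graph n m) → IsTree T → IsTreeUpToIsolated T
IsTree⇒IsTreeUpToIsolated {m = m} T (refl , reach) = record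
  { connected = λ {a} {b} _ _ → reach a b
  ; spanning  = spanning
  }
  where
  spanning : 0 < m → suc m ≤ #active T
  spanning 0<m = ≤-reflexive (sym (trans (sum-cong-≗ (λ v → 1⊓-pos (active v))) (sum-ones (suc m))))
    where
    active : ∀ v → 0 < deg T v
    active v = Reachable-active T (reach v (punchIn v (fromℕ< 0<m)))
                                  (punchInᵢ≢i v (fromℕ< 0<m) ∘ sym)

⌈n/2⌉-pos : ∀ {d} → 0 < d → 0 < ⌈ d /2⌉
⌈n/2⌉-pos {suc d} _ = z<s

sum-⌊deg/2⌋-bound : ∀ {n m} (G : Graph (suc n) m) v₀ → (∀ v → v ≢ v₀ → 0 < deg G v) →
                    sum (λ v → ⌊ deg G v /2⌋) + (⌈ deg G v₀ /2⌉ + n) ≤ m + m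
sum-⌊deg/2⌋-bound {n} {m} G v₀ active = begin
  sum ⌊deg/2⌋ + (⌈ deg G v₀ /2⌉ + n)      ≤⟨ +-monoʳ-≤ (sum ⌊deg/2⌋) ceilings ⟩
  sum ⌊deg/2⌋ + sum ⌈deg/2⌉              ≡⟨ ∑-distrib-+ ⌊deg/2⌋ ⌈deg/2⌉ ⟨
  sum (λ v → ⌊deg/2⌋ v + ⌈deg/2⌉ v)      ≡⟨ sum-cong-≗ (λ v → ⌊n/2⌋+⌈n/2⌉≡n (deg G v)) ⟩
  sum (deg G)                            ≤⟨ handshake G ⟩
  m + m                                  ∎
  where
  open ≤-Reasoning
  ⌊deg/2⌋ ⌈deg/2⌉ : Fin (suc n) → ℕ
  ⌊deg/2⌋ v = ⌊ deg G v /2⌋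
  ⌈deg/2⌉ v = ⌈ deg G v /2⌉
  ceilings : ⌈ deg G v₀ /2⌉ + n ≤ sum ⌈deg/2⌉
  ceilings = begin
    ⌈ deg G v₀ /2⌉ + n                        ≡⟨ cong (⌈ deg G v₀ /2⌉ +_) (sum-ones n) ⟨
    ⌈ deg G v₀ /2⌉ + sum {n} (λ _ → 1)        ≤⟨ +-monoʳ-≤ _ (sum-mono-≤ (λ j →
                                                   ⌈n/2⌉-pos (active (punchIn v₀ j) (punchInᵢ≢i v₀ j)))) ⟩
    ⌈ deg G v₀ /2⌉ + sum (removeAt ⌈deg/2⌉ v₀) ≡⟨ sum-remove {i = v₀} ⌈deg/2⌉ ⟨
    sum ⌈deg/2⌉                               ∎

potential-halfDeg-bound : ∀ {m} (T : Graph (suc m) m) → (∀ u v → Reachable T u v) → ∀ v₀ →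
                          suc (potential T (halfDeg T)) ≤ suc m ∸ ⌈ deg T v₀ /2⌉
potential-halfDeg-bound {m} T reach v₀ = m+n≤o⇒m≤o∸n _ (s≤s (+-cancelʳ-≤ m _ _ (begin
  potential T (halfDeg T) + ⌈ deg T v₀ /2⌉ + m       ≡⟨ +-assoc (potential T (halfDeg T)) _ m ⟩
  potential T (halfDeg T) + (⌈ deg T v₀ /2⌉ + m)     ≤⟨ +-monoˡ-≤ _ potential≤ ⟩
  sum (λ v → ⌊ deg T v /2⌋) + (⌈ deg T v₀ /2⌉ + m)   ≤⟨ sum-⌊deg/2⌋-bound T v₀ active ⟩
  m + m                                              ∎)))
  where
  open ≤-Reasoning
  potential≤ : potential T (halfDeg T) ≤ sum (λ v → ⌊ deg T v /2⌋)
  potential≤ = sum-mono-≤ (λ v → m⊓n≤m (halfDeg T v) (deg T v))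
  active : ∀ v → v ≢ v₀ → 0 < deg T v
  active v v≢v₀ = Reachable-active T (reach v v₀) v≢v₀

length-Efix≤fib : ∀ {n m} (T : Graph n m) → IsTree T → ∀ v →
                  length (Efix T) ≤ fib (n ∸ ⌈ deg T v /2⌉)
length-Efix≤fib {m = m} T tree@(refl , reach) v = begin
  length (Efix T)                      ≤⟨ length-Efix≤countWithin T ⟩
  countWithin T (halfDeg T)            ≤⟨ countWithin≤fib T (halfDeg T) (IsTree⇒IsTreeUpToIsolated T tree) ⟩
  fib (suc (potential T (halfDeg T)))  ≤⟨ fib-mono (potential-halfDeg-bound T reach v) ⟩
  fib (suc m ∸ ⌈ deg T v /2⌉)          ∎
  where open ≤-Reasoning

lemma9 : ∀ {n m} (T : Graph n m) (Δ : ℕ) → IsTree T → IsMaxDegree T Δ →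
           length (Efix T) ≤ fib (n ∸ ⌈ Δ /2⌉)
lemma9 {n} T Δ tree (_ , v , deg≡Δ) =
  subst (λ d → length (Efix T) ≤ fib (n ∸ ⌈ d /2⌉)) deg≡Δ (length-Efix≤fib T tree v)
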